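{- For $n \ge 3$, $\gamma_t^d(P_n) = \lceil 2(n+1)/5 \rceil + 1$ if $n \equiv 1 \pmod 5$, and $\gamma_t^d(P_n) = \lceil 2(n+1)/5 \rceil$ otherwise.
   Context: $P_n$ is the path on $n$ vertices. For a graph $G$ with no isolated vertex, a set $S \subseteq V(G)$ is a disjunctive total dominating set if every vertex of $G$ either is adjacent to a vertex of $S$ or has at least two vertices of $S$ at distance exactly $2$ from it; $\gamma_t^d(G)$ is the minimum cardinality of such a set. -}

module Defs where

open import Data.Nat using (ℕ; zero; suc; _+_; _*_; _≤_; _<_; _/_; _%_)
open import Data.Fin using (Fin; toℕ)
open import Data.Fin.Subset using (Subset; _∈_; ∣_∣)
open import Data.Product using (Σ; ∃; _×_; _,_)
open import Data.Sum using (_⊎_)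
open import Relation.Nullary using (¬_)
open import Relation.Binary.PropositionalEquality using (_≡_)

Graph : ℕ → Set₁
Graph n = Fin n → Fin n → Set

PathGraph : (n : ℕ) → Graph n
PathGraph n i j = (suc (toℕ i) ≡ toℕ j) ⊎ (suc (toℕ j) ≡ toℕ i)

data Walk {n : ℕ} (G : Graph n) : Fin n → Fin n → ℕ → Set where
  here : ∀ {u} → Walk G u u zero
  step : ∀ {u w v k} → G u w → Walk G w v k → Walk G u v (suc k)

Dist : {n : ℕ} → Graph n → Fin n → Fin n → ℕ → Set
Dist G u v d = Walk G u v d × (∀ k → k < d → ¬ Walk G u v k)

IsDTDS : {n : ℕ} → Graph n → Subset n → Set
IsDTDS {n} G S = ∀ (v : Fin n) →
  (Σ (Fin n) λ u → u ∈ S × G v u)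
  ⊎ (Σ (Fin n) λ u → Σ (Fin n) λ w →
       u ∈ S × w ∈ S × ¬ (u ≡ w) × Dist G v u 2 × Dist G v w 2)

DTDNumberIs : {n : ℕ} → Graph n → ℕ → Set
DTDNumberIs {n} G k =
  (Σ (Subset n) λ S → IsDTDS G S × ∣ S ∣ ≡ k)
  × (∀ (S : Subset n) → IsDTDS G S → k ≤ ∣ S ∣)

ceil5 : ℕ → ℕ
ceil5 m = (m + 4) / 5

module Submission where

-- In P_n the neighbours of
-- vertex v are v ± 1 and the vertices at distance exactly 2 are v ± 2, so S is a
-- disjunctive total dominating set (DTDS) iff for every v
--     S(v-1) ∨ S(v+1) ∨ (S(v-2) ∧ S(v+2)),
-- positions outside the path counting as absent.
--
-- Writing n = 3 + k, the claimed value is γ k (= 2,2,3,4,4 for k = 0..4, growing by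
-- 2 every 5 steps).  The upper bound is an explicit periodic set.  The lower bound
-- is a potential-function (transfer-matrix) argument: reading S left to right with a
-- window of four bits, a potential of the remaining length and the window bounds the
-- number of vertices still to come.  The potential is read off from the exact
-- dynamic program and is periodic up to +2 per 5 positions, so its defining local
-- inequalities are finitely many and are verified by evaluation.

open import Defs
open import Data.Bool using (Bool; true; false; _∧_; _∨_; if_then_else_; T)
open import Data.Bool.Properties using (T-∧; T-∨)
open import Data.Nat using (ℕ; zero; suc; _+_; _*_; _∸_; _⊓_; _≤_; _<_; _≤ᵇ_; _%_; _/_; z≤n; s≤s)
open import Data.Nat.Properties
  using (≤-refl; ≤-trans; ≤-reflexive; n≤1+n; +-suc; +-comm; +-monoʳ-≤; +-cancelʳ-≤; <⇒≱; ≤ᵇ⇒≤;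
         suc-injective; m≢1+n+m; module ≤-Reasoning)
open import Data.Nat.Divisibility using (divides)
open import Data.Nat.DivMod using ([m+n]%n≡m%n; +-distrib-/-∣ˡ)
open import Data.Nat.Solver using (module +-*-Solver)
open import Data.Unit using (tt)
open import Data.Empty using (⊥-elim)
open import Data.Fin using (Fin; toℕ; fromℕ<) renaming (zero to fzero; suc to fsuc)
open import Data.Fin.Properties using (toℕ-injective; toℕ-fromℕ<; toℕ<n)
open import Data.Fin.Subset using (Subset; _∈_; ∣_∣)
open import Data.Vec using (Vec; []; _∷_; here; there)
open import Data.Product using (Σ; _×_; _,_; proj₁; proj₂)
open import Data.Sum using (_⊎_; inj₁; inj₂)
open import Function using (_∘_)
open import Function.Bundles using (Equivalence)
open import Relation.Nullary using (¬_)
open import Relation.Binary.PropositionalEquality using (_≡_; refl; sym; trans; cong; subst; module ≡-Reasoning)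

open Equivalence using (to; from)

-- Position k of a bit vector; positions past the end read as absent.
_‼_ : ∀ {m} → Vec Bool m → ℕ → Bool
[] ‼ k = false
(x ∷ S) ‼ zero = x
(x ∷ S) ‼ suc k = S ‼ k

∈⇒‼ : ∀ {m} {S : Subset m} {u : Fin m} → u ∈ S → T (S ‼ toℕ u)
∈⇒‼ here = tt
∈⇒‼ (there u∈S) = ∈⇒‼ u∈S

‼⇒∈ : ∀ {m} (S : Subset m) k → T (S ‼ k) → Σ (Fin m) λ u → toℕ u ≡ k × u ∈ S
‼⇒∈ (true ∷ S) zero _ = fzero , refl , here
‼⇒∈ (x ∷ S) (suc k) t with ‼⇒∈ S k t
... | u , refl , u∈S = fsuc u , refl , there u∈S

bit : Bool → ℕ
bit true = 1
bit false = 0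

∣∷∣ : ∀ {m} x (S : Subset m) → ∣ x ∷ S ∣ ≡ bit x + ∣ S ∣
∣∷∣ true S = refl
∣∷∣ false S = refl

walk-reach : ∀ {n} {u v : Fin n} {k} → Walk (PathGraph n) u v k →
  toℕ v ≤ k + toℕ u × toℕ u ≤ k + toℕ v
walk-reach here = ≤-refl , ≤-refl
walk-reach {u = u} {k = suc k} (step (inj₁ u→w) rest) with walk-reach rest
... | v≤w , w≤v =
  ≤-trans v≤w (≤-reflexive (trans (cong (k +_) (sym u→w)) (+-suc k (toℕ u)))) ,
  ≤-trans (n≤1+n (toℕ u)) (≤-trans (≤-reflexive u→w) (≤-trans w≤v (n≤1+n _)))
walk-reach {k = suc k} (step (inj₂ w→u) rest) with walk-reach rest
... | v≤w , w≤v =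
  ≤-trans v≤w (≤-trans (+-monoʳ-≤ k (≤-trans (n≤1+n _) (≤-reflexive w→u))) (n≤1+n _)) ,
  ≤-trans (≤-reflexive (sym w→u)) (s≤s w≤v)

TwoApart : ∀ {n} → Fin n → Fin n → Set
TwoApart v u = toℕ u ≡ 2 + toℕ v ⊎ toℕ v ≡ 2 + toℕ u

two-apart-no-short-walk : ∀ {n} {u v : Fin n} → TwoApart v u →
  ∀ k → k < 2 → ¬ Walk (PathGraph n) v u k
two-apart-no-short-walk {u = u} {v} (inj₁ u≡) k k<2 w =
  <⇒≱ k<2 (+-cancelʳ-≤ (toℕ v) 2 k (subst (_≤ k + toℕ v) u≡ (proj₁ (walk-reach w))))
two-apart-no-short-walk {u = u} {v} (inj₂ v≡) k k<2 w =
  <⇒≱ k<2 (+-cancelʳ-≤ (toℕ u) 2 k (subst (_≤ k + toℕ u) v≡ (proj₂ (walk-reach w))))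

-- In P_n, distance exactly 2 means that the indices differ by 2: the walk through
-- the vertex in between has length 2 and there is no shorter one ...
two-apart⇒dist2 : ∀ {n} {u v : Fin n} → TwoApart v u → Dist (PathGraph n) v u 2
two-apart⇒dist2 {n} {u} {v} apart@(inj₁ u≡) =
  step (inj₁ (sym mid≡)) (step (inj₁ (trans (cong suc mid≡) (sym u≡))) here) ,
  two-apart-no-short-walk apart
  where
  mid : Fin n
  mid = fromℕ< (≤-trans (n≤1+n _) (subst (_< n) u≡ (toℕ<n u)))
  mid≡ : toℕ mid ≡ suc (toℕ v)
  mid≡ = toℕ-fromℕ< _
two-apart⇒dist2 {n} {u} {v} apart@(inj₂ v≡) =
  step (inj₂ (trans (cong suc mid≡) (sym v≡))) (step (inj₂ (sym mid≡)) here) ,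
  two-apart-no-short-walk apart
  where
  mid : Fin n
  mid = fromℕ< (≤-trans (n≤1+n _) (subst (_< n) v≡ (toℕ<n v)))
  mid≡ : toℕ mid ≡ suc (toℕ u)
  mid≡ = toℕ-fromℕ< _

-- ... and conversely a walk of length 2 either moves twice in one direction or
-- returns to its start, which minimality excludes.
dist2⇒two-apart : ∀ {n} {u v : Fin n} → Dist (PathGraph n) v u 2 → TwoApart v u
dist2⇒two-apart (step (inj₁ e₁) (step (inj₁ e₂) here) , _) =
  inj₁ (trans (sym e₂) (cong suc (sym e₁)))
dist2⇒two-apart (step (inj₂ e₁) (step (inj₂ e₂) here) , _) =
  inj₂ (trans (sym e₁) (cong suc (sym e₂)))
dist2⇒two-apart {n} {u} {v} (step (inj₁ e₁) (step (inj₂ e₂) here) , no-short) =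
  ⊥-elim (no-short 0 (s≤s z≤n) (subst (λ x → Walk (PathGraph n) v x 0)
    (toℕ-injective (suc-injective (trans e₁ (sym e₂)))) here))
dist2⇒two-apart {n} {u} {v} (step (inj₂ e₁) (step (inj₁ e₂) here) , no-short) =
  ⊥-elim (no-short 0 (s≤s z≤n) (subst (λ x → Walk (PathGraph n) v x 0)
    (toℕ-injective (trans (sym e₁) e₂)) here))

-- The local condition at a vertex, given the bits at offsets -2, -1, +1, +2.
covered : Bool → Bool → Bool → Bool → Bool
covered l₂ l₁ r₁ r₂ = l₁ ∨ r₁ ∨ (l₂ ∧ r₂)

-- The condition at position v of a word P; for P = padded S it is the condition
-- at vertex v of S.
CoveredAt : ∀ {m} → Vec Bool m → ℕ → Set
CoveredAt P v = T (covered (P ‼ v) (P ‼ (1 + v)) (P ‼ (3 + v)) (P ‼ (4 + v)))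

-- Two absent positions in front, so that vertex v sits at position 2 + v.
padded : ∀ {n} → Subset n → Vec Bool (2 + n)
padded S = false ∷ false ∷ S

AllCovered : ∀ {n} → Subset n → Set
AllCovered {n} S = ∀ (v : Fin n) → CoveredAt (padded S) (toℕ v)

covered-cases : ∀ {m} (P : Vec Bool m) v → CoveredAt P v →
  T (P ‼ (1 + v)) ⊎ T (P ‼ (3 + v)) ⊎ (T (P ‼ v) × T (P ‼ (4 + v)))
covered-cases P v c with to (T-∨ {P ‼ (1 + v)}) c
... | inj₁ l₁ = inj₁ l₁
... | inj₂ c′ with to (T-∨ {P ‼ (3 + v)}) c′
...   | inj₁ r₁ = inj₂ (inj₁ r₁)
...   | inj₂ far = inj₂ (inj₂ (to T-∧ far))

covered-l₁ : ∀ {m} (P : Vec Bool m) v → T (P ‼ (1 + v)) → CoveredAt P v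
covered-l₁ P v l₁ = from (T-∨ {P ‼ (1 + v)}) (inj₁ l₁)

covered-r₁ : ∀ {m} (P : Vec Bool m) v → T (P ‼ (3 + v)) → CoveredAt P v
covered-r₁ P v r₁ = from (T-∨ {P ‼ (1 + v)}) (inj₂ (from (T-∨ {P ‼ (3 + v)}) (inj₁ r₁)))

covered-far : ∀ {m} (P : Vec Bool m) v → T (P ‼ v) → T (P ‼ (4 + v)) → CoveredAt P v
covered-far P v l₂ r₂ =
  from (T-∨ {P ‼ (1 + v)}) (inj₂ (from (T-∨ {P ‼ (3 + v)}) (inj₂ (from T-∧ (l₂ , r₂)))))

dtds⇒covered : ∀ {n} (S : Subset n) → IsDTDS (PathGraph n) S → AllCovered S
dtds⇒covered S D v with D v
... | inj₁ (u , u∈S , inj₁ v→u) =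
  covered-r₁ (padded S) (toℕ v) (subst (T ∘ (S ‼_)) (sym v→u) (∈⇒‼ u∈S))
... | inj₁ (u , u∈S , inj₂ u→v) =
  covered-l₁ (padded S) (toℕ v) (subst (λ x → T (padded S ‼ suc x)) u→v (∈⇒‼ u∈S))
... | inj₂ (u , w , u∈S , w∈S , u≢w , du , dw) = both (dist2⇒two-apart du) (dist2⇒two-apart dw)
  where
  far : ∀ {x y} → x ∈ S → y ∈ S → toℕ v ≡ 2 + toℕ x → toℕ y ≡ 2 + toℕ v →
    CoveredAt (padded S) (toℕ v)
  far x∈S y∈S v≡ y≡ = covered-far (padded S) (toℕ v)
    (subst (λ z → T (padded S ‼ z)) (sym v≡) (∈⇒‼ x∈S))
    (subst (T ∘ (S ‼_)) y≡ (∈⇒‼ y∈S))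
  -- u ≠ w forces them to lie on opposite sides of v
  both : TwoApart v u → TwoApart v w → CoveredAt (padded S) (toℕ v)
  both (inj₁ u≡) (inj₁ w≡) = ⊥-elim (u≢w (toℕ-injective (trans u≡ (sym w≡))))
  both (inj₂ v≡) (inj₂ v≡′) =
    ⊥-elim (u≢w (toℕ-injective (suc-injective (suc-injective (trans (sym v≡) v≡′)))))
  both (inj₁ u≡) (inj₂ v≡) = far w∈S u∈S v≡ u≡
  both (inj₂ v≡) (inj₁ w≡) = far u∈S w∈S v≡ w≡

covered⇒dtds : ∀ {n} (S : Subset n) → AllCovered S → IsDTDS (PathGraph n) S
covered⇒dtds S C v with toℕ v in v≡ | covered-cases (padded S) (toℕ v) (C v)
... | zero | inj₁ ()
... | suc j | inj₁ left with ‼⇒∈ S j left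
...   | u , u≡ , u∈S = inj₁ (u , u∈S , inj₂ (cong suc u≡))
covered⇒dtds S C v | k | inj₂ (inj₁ right) with ‼⇒∈ S (suc k) right
...   | u , u≡ , u∈S = inj₁ (u , u∈S , inj₁ (sym u≡))
covered⇒dtds S C v | zero | inj₂ (inj₂ (() , _))
covered⇒dtds S C v | suc zero | inj₂ (inj₂ (() , _))
covered⇒dtds S C v | suc (suc j) | inj₂ (inj₂ (far-left , far-right))
  with ‼⇒∈ S j far-left | ‼⇒∈ S (4 + j) far-right
...   | u , u≡ , u∈S | w , w≡ , w∈S =
  inj₂ (u , w , u∈S , w∈S ,
        (λ u≡w → m≢1+n+m j (trans (sym u≡) (trans (cong toℕ u≡w) w≡))) ,
        two-apart⇒dist2 (inj₂ (trans v≡ (cong (2 +_) (sym u≡)))) ,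
        two-apart⇒dist2 (inj₁ (trans w≡ (cong (2 +_) (sym v≡)))))

-- Scanning a word left to right with a window of four bits: scan a b c d L says
-- that in the word a b c d L (followed by absent positions) every position from
-- that of c onwards satisfies the local condition.
scan : ∀ {m} → Bool → Bool → Bool → Bool → Vec Bool m → Bool
scan a b c d [] = covered a b d false ∧ covered b c false false
scan a b c d (x ∷ L) = covered a b d x ∧ scan b c d x L

coveredAt⇒scan : ∀ {m} a b c d (L : Vec Bool m) →
  (∀ v → v < 2 + m → CoveredAt (a ∷ b ∷ c ∷ d ∷ L) v) → T (scan a b c d L)
coveredAt⇒scan a b c d [] C = from T-∧ (C 0 (s≤s z≤n) , C 1 (s≤s (s≤s z≤n)))
coveredAt⇒scan a b c d (x ∷ L) C =
  from T-∧ (C 0 (s≤s z≤n) , coveredAt⇒scan b c d x L (λ v v< → C (suc v) (s≤s v<)))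

scan⇒coveredAt : ∀ {m} a b c d (L : Vec Bool m) → T (scan a b c d L) →
  ∀ v → v < 2 + m → CoveredAt (a ∷ b ∷ c ∷ d ∷ L) v
scan⇒coveredAt a b c d [] ok 0 _ = proj₁ (to T-∧ ok)
scan⇒coveredAt a b c d [] ok 1 _ = proj₂ (to (T-∧ {covered a b d false}) ok)
scan⇒coveredAt a b c d [] ok (suc (suc v)) (s≤s (s≤s ()))
scan⇒coveredAt a b c d (x ∷ L) ok 0 _ = proj₁ (to T-∧ ok)
scan⇒coveredAt a b c d (x ∷ L) ok (suc v) (s≤s v<) =
  scan⇒coveredAt b c d x L (proj₂ (to (T-∧ {covered a b d x}) ok)) v v<

scanFrom : ∀ {k} → Subset (3 + k) → Bool
scanFrom (s₀ ∷ s₁ ∷ R) = scan false false s₀ s₁ R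

dtds⇒scan : ∀ {k} (S : Subset (3 + k)) → IsDTDS (PathGraph (3 + k)) S → T (scanFrom S)
dtds⇒scan S@(s₀ ∷ s₁ ∷ R) D = coveredAt⇒scan false false s₀ s₁ R λ v v< →
  subst (CoveredAt (padded S)) (toℕ-fromℕ< v<) (dtds⇒covered S D (fromℕ< v<))

scan⇒dtds : ∀ {k} (S : Subset (3 + k)) → T (scanFrom S) → IsDTDS (PathGraph (3 + k)) S
scan⇒dtds S@(s₀ ∷ s₁ ∷ R) ok = covered⇒dtds S λ v →
  scan⇒coveredAt false false s₀ s₁ R ok (toℕ v) (toℕ<n v)

BoolPred : ℕ → Set
BoolPred zero = Bool
BoolPred (suc n) = Bool → BoolPred n

Holds : ∀ n → BoolPred n → Set
Holds zero p = T p
Holds (suc n) p = ∀ x → Holds n (p x)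

every : ∀ n → BoolPred n → Bool
every zero p = p
every (suc n) p = every n (p false) ∧ every n (p true)

every-sound : ∀ n (p : BoolPred n) → T (every n p) → Holds n p
every-sound zero p ok = ok
every-sound (suc n) p ok false = every-sound n (p false) (proj₁ (to T-∧ ok))
every-sound (suc n) p ok true = every-sound n (p true) (proj₂ (to (T-∧ {every n (p false)}) ok))

_⇒ᵇ_ : Bool → Bool → Bool
h ⇒ᵇ q = if h then q else true

modus-ponens : ∀ {h q} → T (h ⇒ᵇ q) → T h → T q
modus-ponens {true} ok _ = ok

-- fewest m a b c d is the least number of present positions in a continuation L
-- of length m with scan a b c d L, where 20 stands for "no such continuation"
-- (all values needed below are at most 6).
fewest : ℕ → Bool → Bool → Bool → Bool → ℕ
fewest zero a b c d = if scan a b c d [] then 0 else 20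
fewest (suc m) a b c d = extend false ⊓ extend true
  where
  extend : Bool → ℕ
  extend x = if covered a b d x then bit x + fewest m b c d x else 20

-- The potential: a renormalised copy of fewest for five consecutive lengths,
-- extended to all lengths by adding 2 for every further 5 positions.
potential : ℕ → Bool → Bool → Bool → Bool → ℕ
potential (suc (suc (suc (suc (suc m))))) a b c d = 2 + potential m a b c d
potential m a b c d = fewest (5 + m) a b c d ∸ 2

step-inequality : ℕ → BoolPred 5
step-inequality m a b c d x =
  covered a b d x ⇒ᵇ (potential (suc m) a b c d ≤ᵇ bit x + potential m b c d x)

end-inequality : BoolPred 4
end-inequality a b c d = scan a b c d [] ⇒ᵇ (potential 0 a b c d ≤ᵇ 0)

step-checked : ∀ m → T (every 5 (step-inequality m)) →
  ∀ a b c d x → T (covered a b d x) → potential (suc m) a b c d ≤ bit x + potential m b c d x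
step-checked m ok a b c d x cov =
  ≤ᵇ⇒≤ _ _ (modus-ponens (every-sound 5 (step-inequality m) ok a b c d x) cov)

+2-inside : ∀ x y → x + (2 + y) ≡ 2 + (x + y)
+2-inside x y = trans (+-suc x (suc y)) (cong suc (+-suc x y))

-- The step inequality for every length: checked for m < 5, and transported along
-- the period since both sides grow by 2 every 5 steps.
potential-step : ∀ m a b c d x → T (covered a b d x) →
  potential (suc m) a b c d ≤ bit x + potential m b c d x
potential-step 0 = step-checked 0 tt
potential-step 1 = step-checked 1 tt
potential-step 2 = step-checked 2 tt
potential-step 3 = step-checked 3 tt
potential-step 4 = step-checked 4 tt
potential-step (suc (suc (suc (suc (suc m))))) a b c d x cov = begin
  2 + potential (suc m) a b c d      ≤⟨ +-monoʳ-≤ 2 (potential-step m a b c d x cov) ⟩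
  2 + (bit x + potential m b c d x)  ≡⟨ sym (+2-inside (bit x) _) ⟩
  bit x + (2 + potential m b c d x)  ∎
  where open ≤-Reasoning

potential-end : ∀ a b c d → T (scan a b c d []) → potential 0 a b c d ≤ 0
potential-end a b c d ok =
  ≤ᵇ⇒≤ _ _ (modus-ponens (every-sound 4 end-inequality tt a b c d) ok)

scan-bound : ∀ {m} a b c d (L : Vec Bool m) → T (scan a b c d L) → potential m a b c d ≤ ∣ L ∣
scan-bound a b c d [] ok = potential-end a b c d ok
scan-bound {suc m} a b c d (x ∷ L) ok with to (T-∧ {covered a b d x}) ok
... | cov , rest = begin
  potential (suc m) a b c d  ≤⟨ potential-step m a b c d x cov ⟩
  bit x + potential m b c d x ≤⟨ +-monoʳ-≤ (bit x) (scan-bound b c d x L rest) ⟩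
  bit x + ∣ L ∣              ≡⟨ sym (∣∷∣ x L) ⟩
  ∣ x ∷ L ∣                  ∎
  where open ≤-Reasoning

γ : ℕ → ℕ
γ 0 = 2
γ 1 = 2
γ 2 = 3
γ 3 = 4
γ 4 = 4
γ (suc (suc (suc (suc (suc k))))) = 2 + γ k

entry-inequality : ℕ → BoolPred 2
entry-inequality k s₀ s₁ = γ k ≤ᵇ bit s₀ + (bit s₁ + potential (suc k) false false s₀ s₁)

entry-checked : ∀ k → T (every 2 (entry-inequality k)) →
  ∀ s₀ s₁ → γ k ≤ bit s₀ + (bit s₁ + potential (suc k) false false s₀ s₁)
entry-checked k ok s₀ s₁ = ≤ᵇ⇒≤ _ _ (every-sound 2 (entry-inequality k) ok s₀ s₁)

-- As for the step inequality, k < 5 is checked and both sides have period 5 up to +2.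
entry-bound : ∀ k s₀ s₁ → γ k ≤ bit s₀ + (bit s₁ + potential (suc k) false false s₀ s₁)
entry-bound 0 = entry-checked 0 tt
entry-bound 1 = entry-checked 1 tt
entry-bound 2 = entry-checked 2 tt
entry-bound 3 = entry-checked 3 tt
entry-bound 4 = entry-checked 4 tt
entry-bound (suc (suc (suc (suc (suc k))))) s₀ s₁ = begin
  2 + γ k                      ≤⟨ +-monoʳ-≤ 2 (entry-bound k s₀ s₁) ⟩
  2 + (bit s₀ + (bit s₁ + p))  ≡⟨ sym (+2-inside (bit s₀) _) ⟩
  bit s₀ + (2 + (bit s₁ + p))  ≡⟨ cong (bit s₀ +_) (sym (+2-inside (bit s₁) p)) ⟩
  bit s₀ + (bit s₁ + (2 + p))  ∎
  where
  open ≤-Reasoning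
  p : ℕ
  p = potential (suc k) false false s₀ s₁

lower-bound : ∀ k (S : Subset (3 + k)) → IsDTDS (PathGraph (3 + k)) S → γ k ≤ ∣ S ∣
lower-bound k S@(s₀ ∷ s₁ ∷ R) D = begin
  γ k                        ≤⟨ entry-bound k s₀ s₁ ⟩
  bit s₀ + (bit s₁ + potential (suc k) false false s₀ s₁)
                             ≤⟨ +-monoʳ-≤ (bit s₀) (+-monoʳ-≤ (bit s₁) rest-bound) ⟩
  bit s₀ + (bit s₁ + ∣ R ∣)  ≡⟨ cong (bit s₀ +_) (sym (∣∷∣ s₁ R)) ⟩
  bit s₀ + ∣ s₁ ∷ R ∣        ≡⟨ sym (∣∷∣ s₀ (s₁ ∷ R)) ⟩
  ∣ S ∣                      ∎
  where
  open ≤-Reasoning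
  rest-bound : potential (suc k) false false s₀ s₁ ≤ ∣ R ∣
  rest-bound = scan-bound false false s₀ s₁ R (dtds⇒scan S D)

optimal : ∀ k → Subset (3 + k)
optimal 0 = false ∷ true ∷ true ∷ []
optimal 1 = false ∷ true ∷ true ∷ false ∷ []
optimal 2 = false ∷ true ∷ true ∷ true ∷ false ∷ []
optimal 3 = false ∷ true ∷ true ∷ false ∷ true ∷ true ∷ []
optimal 4 = false ∷ true ∷ true ∷ false ∷ false ∷ true ∷ true ∷ []
optimal (suc (suc (suc (suc (suc k))))) = false ∷ true ∷ true ∷ false ∷ false ∷ optimal k

-- After a full period the scanning window is ●●·· again, so one period can be
-- prepended to any valid continuation.
optimal-scan : ∀ k → T (scan true true false false (optimal k))
optimal-scan 0 = tt
optimal-scan 1 = tt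
optimal-scan 2 = tt
optimal-scan 3 = tt
optimal-scan 4 = tt
optimal-scan (suc (suc (suc (suc (suc k))))) = optimal-scan k

-- The first period (or the whole word, if it is short) brings the window to ●●··.
optimal-scanFrom : ∀ k → T (scanFrom (optimal k))
optimal-scanFrom 0 = tt
optimal-scanFrom 1 = tt
optimal-scanFrom 2 = tt
optimal-scanFrom 3 = tt
optimal-scanFrom 4 = tt
optimal-scanFrom (suc (suc (suc (suc (suc k))))) = optimal-scan k

optimal-size : ∀ k → ∣ optimal k ∣ ≡ γ k
optimal-size 0 = refl
optimal-size 1 = refl
optimal-size 2 = refl
optimal-size 3 = refl
optimal-size 4 = refl
optimal-size (suc (suc (suc (suc (suc k))))) = cong (2 +_) (optimal-size k)

path-dtd-number : ∀ k → DTDNumberIs (PathGraph (3 + k)) (γ k)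
path-dtd-number k =
  (optimal k , scan⇒dtds (optimal k) (optimal-scanFrom k) , optimal-size k) , lower-bound k

ceil-periodic : ∀ k → ceil5 (2 * (3 + (5 + k) + 1)) ≡ 2 + ceil5 (2 * (3 + k + 1))
ceil-periodic k = begin
  (2 * (3 + (5 + k) + 1) + 4) / 5    ≡⟨ cong (_/ 5) shift ⟩
  (10 + m) / 5                       ≡⟨ +-distrib-/-∣ˡ {10} m {5} (divides 2 refl) ⟩
  2 + m / 5                          ∎
  where
  m : ℕ
  m = 2 * (3 + k + 1) + 4
  open ≡-Reasoning
  open +-*-Solver using (solve; _:+_; _:*_; con; _:=_)
  shift : 2 * (3 + (5 + k) + 1) + 4 ≡ 10 + m
  shift = solve 1 (λ x → con 2 :* (con 3 :+ (con 5 :+ x) :+ con 1) :+ con 4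
                       := con 10 :+ (con 2 :* (con 3 :+ x :+ con 1) :+ con 4)) refl k

mod-periodic : ∀ k → (3 + (5 + k)) % 5 ≡ (3 + k) % 5
mod-periodic k = trans (cong (λ x → (3 + x) % 5) (+-comm 5 k)) ([m+n]%n≡m%n (3 + k) 5)

-- γ k is the value claimed in the theorem for n = 3 + k: both sides grow by 2 when
-- k grows by 5, so it suffices to compare them for k < 5.
γ-closed-form : ∀ k →
  ((3 + k) % 5 ≡ 1 → ceil5 (2 * (3 + k + 1)) + 1 ≡ γ k)
  × (¬ ((3 + k) % 5 ≡ 1) → ceil5 (2 * (3 + k + 1)) ≡ γ k)
γ-closed-form 0 = (λ ()) , λ _ → refl
γ-closed-form 1 = (λ ()) , λ _ → refl
γ-closed-form 2 = (λ ()) , λ _ → refl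
γ-closed-form 3 = (λ _ → refl) , λ ≢1 → ⊥-elim (≢1 refl)
γ-closed-form 4 = (λ ()) , λ _ → refl
γ-closed-form (suc (suc (suc (suc (suc k))))) with γ-closed-form k
... | ≡1-case , ≢1-case =
  (λ ≡1 → trans (cong (_+ 1) (ceil-periodic k))
                 (cong (2 +_) (≡1-case (trans (sym (mod-periodic k)) ≡1)))) ,
  (λ ≢1 → trans (ceil-periodic k) (cong (2 +_) (≢1-case (≢1 ∘ trans (mod-periodic k)))))

propositionp : ∀ (n : ℕ) → 3 ≤ n →
    ((n % 5 ≡ 1) → DTDNumberIs (PathGraph n) (ceil5 (2 * (n + 1)) + 1))
    × (¬ (n % 5 ≡ 1) → DTDNumberIs (PathGraph n) (ceil5 (2 * (n + 1))))
propositionp (suc (suc (suc k))) (s≤s (s≤s (s≤s _))) =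
  (λ ≡1 → value-is (proj₁ (γ-closed-form k) ≡1)) , (λ ≢1 → value-is (proj₂ (γ-closed-form k) ≢1))
  where
  value-is : ∀ {c} → c ≡ γ k → DTDNumberIs (PathGraph (3 + k)) c
  value-is c≡γ = subst (DTDNumberIs (PathGraph (3 + k))) (sym c≡γ) (path-dtd-number k)
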